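{- Let $\mathcal{A}_2$ be OPTIMISTIC with $k=2$ and sampling threshold $t$ ($2 < t \le n-2$) on $n$ items with distinct values $v_1 > \dots > v_n$. For $i \in \{1,2\}$ let $P_i$ be the set of permutations (arrival orders) on which $\mathcal{A}_2$ accepts $v_i$, and let \[ P_1' = \{\pi \in P_1 \mid \mathrm{pos}_\pi(v_2) < t \implies \mathcal{A}_2 \text{ accepts } v_1 \text{ as its first accepted item}\}. \] Then $|P_1'| = |P_2|$.
   Context: $\mathrm{pos}_\pi(v)$ denotes the position of item $v$ in the permutation $\pi$. OPTIMISTIC with $k=2$ and threshold $t$: reject the first $t-1$ items; let $s_1 > s_2$ be the two best among them; accept as first item the first item (at position $\ge t$) better than $s_2$; after that, accept as second item the first subsequent item better than $s_1$; decisions are immediate and irrevocable. -}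

module Defs where

open import Data.Nat using (ℕ; zero; suc; _∸_; _<ᵇ_; _≡ᵇ_)
open import Data.Bool using (Bool; true; false; if_then_else_; _∧_; _∨_; not)
open import Data.List using (List; []; _∷_; length; map; concatMap; filter; take; drop; upTo)
open import Data.Bool.ListAction using (any; all)
open import Data.Maybe using (Maybe; just; nothing)
open import Data.Product using (_×_; _,_)
open import Relation.Nullary.Decidable using (T?)

-- Items are identified with their ranks: rank 0 is v₁ (best), rank 1 is v₂,
-- ..., rank n-1 is vₙ.
-- An arrival order (permutation) is a list π of length n listing the ranks
-- in order of arrival: the item at (1-indexed) position p is π[p-1].

allLists : ℕ → ℕ → List (List ℕ)
allLists zero    m = [] ∷ []
allLists (suc k) m = concatMap (λ x → map (x ∷_) (allLists k m)) (upTo m)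

isPermB : ℕ → List ℕ → Bool
isPermB n π = (length π ≡ᵇ n) ∧ all (λ i → any (λ x → x ≡ᵇ i) π) (upTo n)

perms : ℕ → List (List ℕ)
perms n = filter (λ π → T? (isPermB n π)) (allLists n n)

count : ℕ → (List ℕ → Bool) → ℕ
count n P = length (filter (λ π → T? (P π)) (perms n))

-- Best two (smallest ranks) of a list, (s₁ , s₂) with s₁ better than s₂;
-- the sentinel n acts as "worse than every item".
top2 : ℕ → List ℕ → ℕ × ℕ
top2 n []       = n , n
top2 n (x ∷ xs) with top2 n xs
... | a , b = if x <ᵇ a then (x , a) else (if x <ᵇ b then (a , x) else (a , b))

phase2 : ℕ → List ℕ → List ℕ
phase2 s₁ []       = []
phase2 s₁ (x ∷ xs) = if x <ᵇ s₁ then x ∷ [] else phase2 s₁ xs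

phase1 : ℕ → ℕ → List ℕ → List ℕ
phase1 s₁ s₂ []       = []
phase1 s₁ s₂ (x ∷ xs) = if x <ᵇ s₂ then x ∷ phase2 s₁ xs else phase1 s₁ s₂ xs

-- OPTIMISTIC with k = 2 and threshold t on n items: the list of accepted
-- items (ranks) in order of acceptance.  The first t-1 items are the sample.
optimistic2 : ℕ → ℕ → List ℕ → List ℕ
optimistic2 n t π with top2 n (take (t ∸ 1) π)
... | s₁ , s₂ = phase1 s₁ s₂ (drop (t ∸ 1) π)

accepts : ℕ → ℕ → ℕ → List ℕ → Bool
accepts n t i π = any (λ x → x ≡ᵇ i) (optimistic2 n t π)

acceptsFirst : ℕ → ℕ → ℕ → List ℕ → Bool
acceptsFirst n t i π with optimistic2 n t π
... | []    = false
... | x ∷ _ = x ≡ᵇ i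

-- pos_π(item of rank i) < t, i.e. the item lies among the first t-1 arrivals.
posLt : ℕ → ℕ → List ℕ → Bool
posLt t i π = any (λ x → x ≡ᵇ i) (take (t ∸ 1) π)

inP1' : ℕ → ℕ → List ℕ → Bool
inP1' n t π = accepts n t 0 π ∧ (not (posLt t 1 π) ∨ acceptsFirst n t 0 π)

inP2 : ℕ → ℕ → List ℕ → Bool
inP2 n t π = accepts n t 1 π

-- Let σ swap the two best items v₁ and v₂ (ranks 0 and 1).  As σ permutes the arrival orders,
-- it suffices that π ∈ P₁' iff σπ ∈ P₂, by cases on the sample S.  If v₁ ∈ S, it is never
-- accepted on π, and v₂ = σv₁ is never accepted on σπ.  If v₁, v₂ ∉ S, both thresholds are worse
-- than v₂, so the algorithm cannot tell v₁ from v₂ and its run on σπ is σ of its run on π.  If only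
-- v₂ ∈ S, then s₁ = v₂ on π, while σπ has the same s₂ but s₁ = v₁ and so accepts no second item:
-- v₂ is accepted on σπ iff it is accepted first there, iff v₁ is accepted first on π.
-- Arrival orders are the length-n lists covering {0,…,n-1}; that they repeat no entry is a
-- pigeonhole count.

module Submission where

open import Defs
open import Algebra.Bundles using (CommutativeMonoid)
import Algebra.Properties.CommutativeSemigroup as CommSemigroupProperties
open import Data.Bool using (Bool; true; false; if_then_else_; _∧_; _∨_; not)
open import Data.Bool.Properties
  using (∧-commutativeMonoid; ∧-identityʳ; ∧-zeroʳ; ∨-identityʳ; ∨-conicalˡ; ∨-conicalʳ; ¬-not; T-∧; T-≡)
  renaming (_≟_ to _≟ᴮ_)
open import Data.Bool.ListAction using (any; all; and)
open import Data.List
  using (List; []; _∷_; length; map; filter; concatMap; take; drop; _++_; applyUpTo; upTo)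
open import Data.List.Properties
  using ( length-map; map-∘; map-id-local; map-cong-local; map-concatMap; concatMap-cong
        ; concatMap-map; take-map; drop-map; take++drop≡id)
open import Data.List.Membership.Propositional using (_∈_)
open import Data.List.Membership.Propositional.Properties using (∈-filter⁻; ∈-upTo⁺)
open import Data.List.Relation.Unary.Any using (here; there)
open import Data.List.Relation.Unary.All as All using (All; []; _∷_)
open import Data.List.Relation.Unary.All.Properties
  using (all⁺; all-upTo; applyUpTo⁺₂; concat⁺; map⁺)
import Data.List.Relation.Binary.Permutation.Propositional as ↭
open ↭ using (_↭_; ↭-refl; module PermutationReasoning)
open import Data.List.Relation.Binary.Permutation.Propositional.Properties
  using (↭-length; filter-↭; ++⁺; ++⁺ˡ; shifts) renaming (map⁺ to map⁺-↭)
open import Data.Nat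
  using (ℕ; zero; suc; pred; _+_; _*_; _∸_; _≤_; _<_; _≡ᵇ_; _<ᵇ_; z≤n; s≤s; _≤?_)
open import Data.Nat.Properties
  using ( _≟_; ≡ᵇ⇒≡; ≡⇒≡ᵇ; +-commutativeSemigroup; +-comm; *-zeroʳ; *-identityʳ
        ; ≤-refl; ≤-trans; ≤-antisym; <⇒≤; <⇒≢; >⇒≢; ≰⇒>; n≮n; n<1+n; n≤1+n; n≤0⇒n≡0
        ; m≤m+n; m<1+n⇒m<n∨m≡n; +-mono-≤; +-monoˡ-≤; +-cancelˡ-≤; module ≤-Reasoning)
open import Data.Product using (_×_; _,_; proj₁; proj₂; ∃-syntax)
open import Data.Sum using (inj₁; inj₂)
open import Data.Empty using (⊥-elim)
open import Function using (_∘_; Equivalence)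
open import Relation.Nullary using (yes; no)
open import Relation.Nullary.Decidable using (T?)
open import Relation.Binary.PropositionalEquality
  using (_≡_; _≢_; refl; sym; trans; cong; cong₂; subst; module ≡-Reasoning)

open CommSemigroupProperties +-commutativeSemigroup using (interchange)
open CommSemigroupProperties (CommutativeMonoid.commutativeSemigroup ∧-commutativeMonoid)
  using (x∙yz≈y∙xz)

private variable A B : Set

concatMap-↭ˡ : ∀ (f : A → List B) {xs ys} → xs ↭ ys → concatMap f xs ↭ concatMap f ys
concatMap-↭ˡ f ↭.refl         = ↭-refl
concatMap-↭ˡ f (↭.prep x p)   = ++⁺ˡ (f x) (concatMap-↭ˡ f p)
concatMap-↭ˡ f (↭.swap x y p) = ↭.trans (shifts (f x) (f y)) (++⁺ˡ (f y) (++⁺ˡ (f x) (concatMap-↭ˡ f p)))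
concatMap-↭ˡ f (↭.trans p q)  = ↭.trans (concatMap-↭ˡ f p) (concatMap-↭ˡ f q)

concatMap-↭ʳ : ∀ {f g : A → List B} xs → (∀ x → f x ↭ g x) → concatMap f xs ↭ concatMap g xs
concatMap-↭ʳ []       f↭g = ↭-refl
concatMap-↭ʳ (x ∷ xs) f↭g = ++⁺ (f↭g x) (concatMap-↭ʳ xs f↭g)

filter-map : ∀ (P : B → Bool) (f : A → B) xs →
             filter (λ y → T? (P y)) (map f xs) ≡ map f (filter (λ x → T? (P (f x))) xs)
filter-map P f []       = refl
filter-map P f (x ∷ xs) with P (f x)
... | true  = cong (f x ∷_) (filter-map P f xs)
... | false = filter-map P f xs

filter-cong-∈ : ∀ {P Q : A → Bool} xs → (∀ {x} → x ∈ xs → P x ≡ Q x) →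
                filter (λ x → T? (P x)) xs ≡ filter (λ x → T? (Q x)) xs
filter-cong-∈             []       P≡Q = refl
filter-cong-∈ {P = P} {Q} (x ∷ xs) P≡Q rewrite P≡Q (here refl) with Q x
... | true  = cong (x ∷_) (filter-cong-∈ xs (P≡Q ∘ there))
... | false = filter-cong-∈ xs (P≡Q ∘ there)

length-filter-↭-map : ∀ (P Q : A → Bool) (f : A → A) xs → map f xs ↭ xs →
                      (∀ {x} → x ∈ xs → P x ≡ Q (f x)) →
                      length (filter (λ x → T? (P x)) xs) ≡ length (filter (λ x → T? (Q x)) xs)
length-filter-↭-map P Q f xs fxs↭xs P≡Q∘f = begin
  length (filter (λ x → T? (P x)) xs)           ≡⟨ cong length (filter-cong-∈ xs P≡Q∘f) ⟩
  length (filter (λ x → T? (Q (f x))) xs)       ≡⟨ length-map f (filter (λ x → T? (Q (f x))) xs) ⟨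
  length (map f (filter (λ x → T? (Q (f x))) xs)) ≡⟨ cong length (filter-map Q f xs) ⟨
  length (filter (λ x → T? (Q x)) (map f xs))   ≡⟨ ↭-length (filter-↭ (λ x → T? (Q x)) fxs↭xs) ⟩
  length (filter (λ x → T? (Q x)) xs)           ∎
  where open ≡-Reasoning

sumBelow : ℕ → (ℕ → ℕ) → ℕ
sumBelow zero    f = 0
sumBelow (suc n) f = sumBelow n f + f n

sumBelow-+ : ∀ n f g → sumBelow n (λ i → f i + g i) ≡ sumBelow n f + sumBelow n g
sumBelow-+ zero    f g = refl
sumBelow-+ (suc n) f g = trans (cong (_+ (f n + g n)) (sumBelow-+ n f g))
                               (interchange (sumBelow n f) (sumBelow n g) (f n) (g n))

sumBelow-mono : ∀ n {f g} → (∀ i → i < n → f i ≤ g i) → sumBelow n f ≤ sumBelow n g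
sumBelow-mono zero    f≤g = z≤n
sumBelow-mono (suc n) f≤g =
  +-mono-≤ (sumBelow-mono n (λ i i<n → f≤g i (≤-trans i<n (n≤1+n n)))) (f≤g n ≤-refl)

sumBelow-const : ∀ n c → sumBelow n (λ _ → c) ≡ n * c
sumBelow-const zero    c = refl
sumBelow-const (suc n) c = trans (cong (_+ c) (sumBelow-const n c)) (+-comm (n * c) c)

≢⇒≡ᵇ≡false : ∀ {m n} → m ≢ n → (m ≡ᵇ n) ≡ false
≢⇒≡ᵇ≡false m≢n = ¬-not (m≢n ∘ ≡ᵇ⇒≡ _ _ ∘ Equivalence.from T-≡)

indicator : ℕ → ℕ → ℕ
indicator x i = if x ≡ᵇ i then 1 else 0

sumBelow-indicator≡0 : ∀ {x} n → n ≤ x → sumBelow n (indicator x) ≡ 0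
sumBelow-indicator≡0 zero    _     = refl
sumBelow-indicator≡0 {x} (suc n) n<x
  rewrite ≢⇒≡ᵇ≡false (>⇒≢ n<x) | sumBelow-indicator≡0 n (<⇒≤ n<x) = refl

sumBelow-indicator≡1 : ∀ {x} n → x < n → sumBelow n (indicator x) ≡ 1
sumBelow-indicator≡1 {x} (suc n) x<1+n with m<1+n⇒m<n∨m≡n x<1+n
... | inj₁ x<n rewrite ≢⇒≡ᵇ≡false (<⇒≢ x<n) | sumBelow-indicator≡1 n x<n = refl
... | inj₂ refl rewrite Equivalence.to T-≡ (≡⇒≡ᵇ x x refl) | sumBelow-indicator≡0 x ≤-refl = refl

-- The run of OPTIMISTIC under swapping v₁ and v₂

swap01 : ℕ → ℕ
swap01 0 = 1
swap01 1 = 0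
swap01 k@(suc (suc _)) = k

swap01-≥2 : ∀ {x} → 2 ≤ x → swap01 x ≡ x
swap01-≥2 (s≤s (s≤s _)) = refl

swap01-≡ᵇ : ∀ x y → (swap01 x ≡ᵇ swap01 y) ≡ (x ≡ᵇ y)
swap01-≡ᵇ 0             0             = refl
swap01-≡ᵇ 0             1             = refl
swap01-≡ᵇ 0             (suc (suc _)) = refl
swap01-≡ᵇ 1             0             = refl
swap01-≡ᵇ 1             1             = refl
swap01-≡ᵇ 1             (suc (suc _)) = refl
swap01-≡ᵇ (suc (suc _)) 0             = refl
swap01-≡ᵇ (suc (suc _)) 1             = refl
swap01-≡ᵇ (suc (suc _)) (suc (suc _)) = refl

swap01-<ᵇ : ∀ x {a} → 2 ≤ a → (swap01 x <ᵇ a) ≡ (x <ᵇ a)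
swap01-<ᵇ 0             (s≤s (s≤s _)) = refl
swap01-<ᵇ 1             (s≤s (s≤s _)) = refl
swap01-<ᵇ (suc (suc _)) _             = refl

mem : ℕ → List ℕ → Bool
mem i = any (_≡ᵇ i)

headIs : ℕ → List ℕ → Bool
headIs i []      = false
headIs i (x ∷ _) = x ≡ᵇ i

mem-map-swap01 : ∀ i xs → mem (swap01 i) (map swap01 xs) ≡ mem i xs
mem-map-swap01 i []       = refl
mem-map-swap01 i (x ∷ xs) = cong₂ _∨_ (swap01-≡ᵇ x i) (mem-map-swap01 i xs)

headIs⇒mem : ∀ i xs → headIs i xs ≡ true → mem i xs ≡ true
headIs⇒mem i (x ∷ xs) h rewrite h = refl

mem-∧-headIs : ∀ i xs → mem i xs ∧ headIs i xs ≡ headIs i xs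
mem-∧-headIs i xs with headIs i xs in h
... | true  rewrite headIs⇒mem i xs h = refl
... | false = ∧-zeroʳ (mem i xs)

phase2-map-swap01 : ∀ {a} R → 2 ≤ a → phase2 a (map swap01 R) ≡ map swap01 (phase2 a R)
phase2-map-swap01     []      a≥2 = refl
phase2-map-swap01 {a} (x ∷ R) a≥2 rewrite swap01-<ᵇ x a≥2 with x <ᵇ a
... | true  = refl
... | false = phase2-map-swap01 R a≥2

phase1-map-swap01 : ∀ {a b} R → 2 ≤ a → 2 ≤ b →
                    phase1 a b (map swap01 R) ≡ map swap01 (phase1 a b R)
phase1-map-swap01         []      a≥2 b≥2 = refl
phase1-map-swap01 {a} {b} (x ∷ R) a≥2 b≥2 rewrite swap01-<ᵇ x b≥2 with x <ᵇ b
... | true  = cong (swap01 x ∷_) (phase2-map-swap01 R a≥2)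
... | false = phase1-map-swap01 R a≥2 b≥2

phase2-absent : ∀ {i} a R → mem i R ≡ false → mem i (phase2 a R) ≡ false
phase2-absent a []      i∉R = refl
phase2-absent a (x ∷ R) i∉R with x <ᵇ a
... | true  = cong (_∨ false) (∨-conicalˡ _ _ i∉R)
... | false = phase2-absent a R (∨-conicalʳ _ _ i∉R)

phase1-absent : ∀ {i} a b R → mem i R ≡ false → mem i (phase1 a b R) ≡ false
phase1-absent a b []      i∉R = refl
phase1-absent a b (x ∷ R) i∉R with x <ᵇ b
... | true  = cong₂ _∨_ (∨-conicalˡ _ _ i∉R) (phase2-absent a R (∨-conicalʳ _ _ i∉R))
... | false = phase1-absent a b R (∨-conicalʳ _ _ i∉R)

phase2-zero : ∀ R → phase2 0 R ≡ []
phase2-zero []      = refl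
phase2-zero (x ∷ R) = phase2-zero R

phase1-headIs-swap01 : ∀ {b} R → 2 ≤ b →
                       headIs 0 (phase1 1 b R) ≡ mem 1 (phase1 0 b (map swap01 R))
phase1-headIs-swap01     []      b≥2 = refl
phase1-headIs-swap01 {b} (x ∷ R) b≥2 rewrite swap01-<ᵇ x b≥2 with x <ᵇ b
... | true  rewrite phase2-zero (map swap01 R) | ∨-identityʳ (swap01 x ≡ᵇ 1) = sym (swap01-≡ᵇ x 0)
... | false = phase1-headIs-swap01 R b≥2

occ : ℕ → List ℕ → ℕ
occ i []       = 0
occ i (x ∷ xs) = (if x ≡ᵇ i then 1 else 0) + occ i xs

occ-++ : ∀ i xs ys → occ i (xs ++ ys) ≡ occ i xs + occ i ys
occ-++ i []       ys = refl
occ-++ i (x ∷ xs) ys with x ≡ᵇ i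
... | true  = cong suc (occ-++ i xs ys)
... | false = occ-++ i xs ys

occ≡0⇒absent : ∀ i xs → occ i xs ≡ 0 → mem i xs ≡ false
occ≡0⇒absent i []       _ = refl
occ≡0⇒absent i (x ∷ xs) h with x ≡ᵇ i
... | false = occ≡0⇒absent i xs h

mem⇒occ≥1 : ∀ i xs → mem i xs ≡ true → 1 ≤ occ i xs
mem⇒occ≥1 i (x ∷ xs) h with x ≡ᵇ i
... | true  = s≤s z≤n
... | false = mem⇒occ≥1 i xs h

absent01⇒≥2 : ∀ xs → mem 0 xs ≡ false → mem 1 xs ≡ false → All (2 ≤_) xs
absent01⇒≥2 []                  _ _ = []
absent01⇒≥2 (suc (suc _) ∷ xs) h₀ h₁ = s≤s (s≤s z≤n) ∷ absent01⇒≥2 xs h₀ h₁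

top2-All : ∀ {P : ℕ → Set} {n} S → P n → All P S → P (proj₁ (top2 n S)) × P (proj₂ (top2 n S))
top2-All {n = n} []      Pn []         = Pn , Pn
top2-All {n = n} (x ∷ S) Pn (Px ∷ PS) with top2 n S | top2-All S Pn PS
... | a , b | Pa , Pb with x <ᵇ a
...   | true  = Px , Pa
...   | false with x <ᵇ b
...     | true  = Pa , Px
...     | false = Pa , Pb

top2-swap01 : ∀ {n} S → 2 ≤ n → mem 0 S ≡ false → occ 1 S ≡ 1 →
              ∃[ b ] 2 ≤ b × top2 n S ≡ (1 , b) × top2 n (map swap01 S) ≡ (0 , b)
top2-swap01 {n} (1 ∷ S) n≥2 0∉S occ≡1
  with S≥2 ← absent01⇒≥2 S 0∉S (occ≡0⇒absent 1 S (cong pred occ≡1))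
  rewrite map-id-local (All.map swap01-≥2 S≥2) with top2 n S | top2-All S n≥2 S≥2
... | suc (suc a) , _ | s≤s (s≤s _) , _ = suc (suc a) , s≤s (s≤s z≤n) , refl , refl
top2-swap01 {n} (suc (suc k) ∷ S) n≥2 0∉S occ≡1 with top2-swap01 S n≥2 0∉S occ≡1
... | b , b≥2 , e , e′ rewrite e | e′ with suc (suc k) <ᵇ b
...   | true  = suc (suc k) , s≤s (s≤s z≤n) , refl , refl
...   | false = b , b≥2 , refl , refl

run : ℕ → List ℕ → List ℕ → List ℕ
run n S R = phase1 (proj₁ (top2 n S)) (proj₂ (top2 n S)) R

inP1'-run : ℕ → List ℕ → List ℕ → Bool
inP1'-run n S R = mem 0 (run n S R) ∧ (not (mem 1 S) ∨ headIs 0 (run n S R))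

inP2-run : ℕ → List ℕ → List ℕ → Bool
inP2-run n S R = mem 1 (run n S R)

inP1'-run-swap01-v₁-sampled : ∀ n S R → mem 0 R ≡ false →
                        inP1'-run n S R ≡ inP2-run n (map swap01 S) (map swap01 R)
inP1'-run-swap01-v₁-sampled n S R 0∉R
  rewrite phase1-absent (proj₁ (top2 n S)) (proj₂ (top2 n S)) R 0∉R
        | phase1-absent (proj₁ (top2 n (map swap01 S))) (proj₂ (top2 n (map swap01 S))) (map swap01 R)
                        (trans (mem-map-swap01 0 R) 0∉R)
  = refl

inP1'-run-swap01-v₂-sampled : ∀ n S R → 2 ≤ n → mem 0 S ≡ false → mem 1 S ≡ true → occ 1 S ≤ 1 →
                        inP1'-run n S R ≡ inP2-run n (map swap01 S) (map swap01 R)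
inP1'-run-swap01-v₂-sampled n S R n≥2 0∉S 1∈S occ≤1
  with b , b≥2 , e , e′ ← top2-swap01 S n≥2 0∉S (≤-antisym occ≤1 (mem⇒occ≥1 1 S 1∈S))
  rewrite e | e′ | 1∈S
  = trans (mem-∧-headIs 0 (phase1 1 b R)) (phase1-headIs-swap01 R b≥2)

inP1'-run-swap01-unsampled : ∀ n S R → 2 ≤ n → mem 0 S ≡ false → mem 1 S ≡ false →
                       inP1'-run n S R ≡ inP2-run n (map swap01 S) (map swap01 R)
inP1'-run-swap01-unsampled n S R n≥2 0∉S 1∉S
  with S≥2 ← absent01⇒≥2 S 0∉S 1∉S
  rewrite map-id-local (All.map swap01-≥2 S≥2) | 1∉S
  with a≥2 , b≥2 ← top2-All S n≥2 S≥2
  rewrite phase1-map-swap01 R a≥2 b≥2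
  = trans (∧-identityʳ _) (sym (mem-map-swap01 0 (run n S R)))

inP1'-run-swap01 : ∀ n S R → 2 ≤ n → (mem 0 S ≡ true → mem 0 R ≡ false) → occ 1 S ≤ 1 →
             inP1'-run n S R ≡ inP2-run n (map swap01 S) (map swap01 R)
inP1'-run-swap01 n S R n≥2 0∈S⇒0∉R occ≤1 with mem 0 S ≟ᴮ true | mem 1 S ≟ᴮ true
... | yes 0∈S | _       = inP1'-run-swap01-v₁-sampled n S R (0∈S⇒0∉R 0∈S)
... | no 0∉S  | yes 1∈S = inP1'-run-swap01-v₂-sampled n S R n≥2 (¬-not 0∉S) 1∈S occ≤1
... | no 0∉S  | no 1∉S  = inP1'-run-swap01-unsampled n S R n≥2 (¬-not 0∉S) (¬-not 1∉S)

acceptsFirst≡headIs : ∀ n t i π → acceptsFirst n t i π ≡ headIs i (optimistic2 n t π)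
acceptsFirst≡headIs n t i π with optimistic2 n t π
... | []    = refl
... | _ ∷ _ = refl

inP1'≡inP2-swap01 : ∀ n t π → 2 ≤ n → occ 0 π ≤ 1 → occ 1 π ≤ 1 → inP1' n t π ≡ inP2 n t (map swap01 π)
inP1'≡inP2-swap01 n t π n≥2 occ₀≤1 occ₁≤1
  rewrite acceptsFirst≡headIs n t 0 π | take-map {f = swap01} (t ∸ 1) π | drop-map {f = swap01} (t ∸ 1) π
  = inP1'-run-swap01 n S R n≥2 0∈S⇒0∉R (≤-trans (m≤m+n (occ 1 S) (occ 1 R)) (occ-split≤1 1 occ₁≤1))
  where
  S = take (t ∸ 1) π
  R = drop (t ∸ 1) π
  occ-split≤1 : ∀ i → occ i π ≤ 1 → occ i S + occ i R ≤ 1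
  occ-split≤1 i = subst (_≤ 1) (trans (cong (occ i) (sym (take++drop≡id (t ∸ 1) π))) (occ-++ i S R))
  0∈S⇒0∉R : mem 0 S ≡ true → mem 0 R ≡ false
  0∈S⇒0∉R 0∈S = occ≡0⇒absent 0 R (n≤0⇒n≡0 (+-cancelˡ-≤ 1 _ _
                  (≤-trans (+-monoˡ-≤ (occ 0 R) (mem⇒occ≥1 0 S 0∈S)) (occ-split≤1 0 occ₀≤1))))

-- Arrival orders

sumBelow-occ : ∀ n π → All (_< n) π → sumBelow n (λ i → occ i π) ≡ length π
sumBelow-occ n []      []          = trans (sumBelow-const n 0) (*-zeroʳ n)
sumBelow-occ n (x ∷ π) (x<n ∷ π<n) = trans (sumBelow-+ n (indicator x) (λ i → occ i π))
                                           (cong₂ _+_ (sumBelow-indicator≡1 n x<n) (sumBelow-occ n π π<n))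

pigeonhole-occ≤1 : ∀ {n j} π → All (_< n) π → length π ≡ n → (∀ i → i < n → 1 ≤ occ i π) → j < n →
                    occ j π ≤ 1
pigeonhole-occ≤1 {n} {j} π π<n length≡n covers j<n with occ j π ≤? 1
... | yes occ≤1 = occ≤1
... | no  occ≰1 = ⊥-elim (n≮n n (begin-strict
  n                                                  <⟨ n<1+n n ⟩
  1 + n                                              ≡⟨ cong₂ _+_ (sumBelow-indicator≡1 n j<n)
                                                                 (trans (sumBelow-const n 1) (*-identityʳ n)) ⟨
  sumBelow n (indicator j) + sumBelow n (λ _ → 1)    ≡⟨ sumBelow-+ n (indicator j) (λ _ → 1) ⟨
  sumBelow n (λ i → indicator j i + 1)               ≤⟨ sumBelow-mono n extra-copy-of-j ⟩
  sumBelow n (λ i → occ i π)                         ≡⟨ sumBelow-occ n π π<n ⟩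
  length π                                           ≡⟨ length≡n ⟩
  n                                                  ∎))
  where
  open ≤-Reasoning
  extra-copy-of-j : ∀ i → i < n → indicator j i + 1 ≤ occ i π
  extra-copy-of-j i i<n with j ≟ i
  ... | yes refl rewrite Equivalence.to T-≡ (≡⇒≡ᵇ j j refl) = ≰⇒> occ≰1
  ... | no  j≢i  rewrite ≢⇒≡ᵇ≡false j≢i = covers i i<n

allLists-< : ∀ k m → All (All (_< m)) (allLists k m)
allLists-< zero    m = [] ∷ []
allLists-< (suc k) m =
  concat⁺ (map⁺ (All.map (λ x<m → map⁺ (All.map (x<m ∷_) (allLists-< k m))) (all-upTo m)))

∈-perms⇒occ≤1 : ∀ n {π i} → π ∈ perms n → i < n → occ i π ≤ 1
∈-perms⇒occ≤1 n {π} π∈perms i<n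
  with π∈allLists , isPerm ← ∈-filter⁻ (λ π → T? (isPermB n π)) π∈perms
  with length≡n , covers ← Equivalence.to T-∧ isPerm
  = pigeonhole-occ≤1 π (All.lookup (allLists-< n n) π∈allLists) (≡ᵇ⇒≡ _ _ length≡n)
      (λ i i<n → mem⇒occ≥1 i π (Equivalence.to T-≡ (All.lookup covers′ (∈-upTo⁺ i<n)))) i<n
  where covers′ = all⁺ (λ i → mem i π) (upTo n) covers

allLists-map-↭ : ∀ (f : ℕ → ℕ) k {m} → map f (upTo m) ↭ upTo m →
                 map (map f) (allLists k m) ↭ allLists k m
allLists-map-↭ f zero    fU↭U = ↭-refl
allLists-map-↭ f (suc k) {m} fU↭U = begin
  map (map f) (concatMap (λ x → map (x ∷_) L) U)
    ≡⟨ map-concatMap (map f) _ U ⟩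
  concatMap (λ x → map (map f) (map (x ∷_) L)) U
    ≡⟨ concatMap-cong (λ x → trans (sym (map-∘ L)) (map-∘ L)) U ⟩
  concatMap (λ x → map (f x ∷_) (map (map f) L)) U
    ↭⟨ concatMap-↭ʳ U (λ x → map⁺-↭ (f x ∷_) (allLists-map-↭ f k fU↭U)) ⟩
  concatMap (λ x → map (f x ∷_) L) U
    ≡⟨ concatMap-map (λ y → map (y ∷_) L) f U ⟨
  concatMap (λ y → map (y ∷_) L) (map f U)
    ↭⟨ concatMap-↭ˡ (λ y → map (y ∷_) L) fU↭U ⟩
  concatMap (λ y → map (y ∷_) L) U
    ∎
  where
  open PermutationReasoning
  U = upTo m
  L = allLists k m

upTo-swap01 : ∀ m → map swap01 (upTo (2 + m)) ↭ upTo (2 + m)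
upTo-swap01 m = ↭.swap 1 0 (↭.↭-reflexive (map-id-local (applyUpTo⁺₂ (λ i → 2 + i) m (λ _ → refl))))

isPermB-swap01 : ∀ m π → isPermB (2 + m) (map swap01 π) ≡ isPermB (2 + m) π
isPermB-swap01 m π = cong₂ _∧_ (cong (_≡ᵇ 2 + m) (length-map swap01 π)) (begin
  mem 0 (map swap01 π) ∧ (mem 1 (map swap01 π) ∧ all (λ i → mem i (map swap01 π)) rest)
    ≡⟨ cong₂ _∧_ (mem-map-swap01 1 π) (cong₂ _∧_ (mem-map-swap01 0 π) (cong and (map-cong-local
         (applyUpTo⁺₂ (λ i → 2 + i) m (λ i → mem-map-swap01 (2 + i) π))))) ⟩
  mem 1 π ∧ (mem 0 π ∧ all (λ i → mem i π) rest)
    ≡⟨ x∙yz≈y∙xz (mem 1 π) (mem 0 π) _ ⟩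
  mem 0 π ∧ (mem 1 π ∧ all (λ i → mem i π) rest) ∎)
  where
  open ≡-Reasoning
  rest = applyUpTo (λ i → 2 + i) m

perms-swap01 : ∀ m → map (map swap01) (perms (2 + m)) ↭ perms (2 + m)
perms-swap01 m = begin
  map (map swap01) (filter isPerm? (allLists n n))
    ≡⟨ cong (map (map swap01)) (filter-cong-∈ (allLists n n) (λ {π} _ → sym (isPermB-swap01 m π))) ⟩
  map (map swap01) (filter (λ π → T? (isPermB n (map swap01 π))) (allLists n n))
    ≡⟨ filter-map (isPermB n) (map swap01) (allLists n n) ⟨
  filter isPerm? (map (map swap01) (allLists n n))
    ↭⟨ filter-↭ isPerm? (allLists-map-↭ swap01 n (upTo-swap01 m)) ⟩
  filter isPerm? (allLists n n) ∎
  where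
  open PermutationReasoning
  n = 2 + m
  isPerm? = λ π → T? (isPermB n π)

lemma13 : (n t : ℕ) → 2 < t → t ≤ n ∸ 2 →
          count n (inP1' n t) ≡ count n (inP2 n t)
-- The bounds on t are only used to force n ≥ 2.
lemma13 0 _ (s≤s (s≤s (s≤s _))) ()
lemma13 1 _ (s≤s (s≤s (s≤s _))) ()
lemma13 (suc (suc m)) t _ _ =
  length-filter-↭-map (inP1' n t) (inP2 n t) (map swap01) (perms n) (perms-swap01 m)
    (λ {π} π∈perms → inP1'≡inP2-swap01 n t π (s≤s (s≤s z≤n))
                   (∈-perms⇒occ≤1 n π∈perms (s≤s z≤n)) (∈-perms⇒occ≤1 n π∈perms (s≤s (s≤s z≤n))))
  where n = 2 + m
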